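{- Let $G$ be a pointed dag, $k\ge 1$, $w$ a vertex of $G$ with (immediate) predecessors $u$ and $v$. Then each clause in $x_w^{k\oplus}$ has a dag-like resolution derivation $P$ from the clauses in $x_u^{k\oplus}$, $x_v^{k\oplus}$ and $(\overline x_u\lor\overline x_v\lor x_w)^{k\oplus}$, which contains fewer than $2^{2k}$ resolution inferences and resolves on the variables $x_{u,i}$ and $x_{v,i}$; in addition, the paths in $P$ leading to clauses of $x_v^{k\oplus}$ resolve on exactly the variables $x_{v,i}$.
   Context: A pointed dag is a directed acyclic graph with a single sink in which every vertex has indegree $0$ or $2$. For each vertex $a$ and $k>0$ there are variables $x_{a,1},\dots,x_{a,k}$; with $y^1=y$, $y^{ -1}=\overline y$, $x_a^{k\oplus}$ is the set of clauses $x_{a,1}^{i_1}\lor\cdots\lor x_{a,k}^{i_k}$ with an even number of $i_j$ equal to $-1$, and $\overline x_a^{k\oplus}$ the set of such clauses with an odd number equal to $-1$. For a clause $E=z_1\lor\cdots\lor z_\ell$ with each $z_i$ of the form $x_a$ or $\overline x_a$, $E^{k\oplus}$ is the set of clauses $E_1\lor\cdots\lor E_\ell$ with $E_i\in z_i^{k\oplus}$. -}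

module Defs where

open import Data.Nat using (ℕ; zero; suc; _<_; _≤_; _^_; _*_)
open import Data.Nat.Divisibility using (_∣_)
open import Data.Fin using (Fin; fromℕ) renaming (_<_ to _<ᶠ_; _≟_ to _≟ᶠ_)
open import Data.Bool using (Bool; true; false; _∧_; _∨_; not; if_then_else_) renaming (_≟_ to _≟ᵇ_)
open import Data.Product using (Σ; _×_; _,_; proj₁; proj₂)
open import Data.Sum using (_⊎_)
open import Data.List using (List; []; _∷_; map; allFin)
open import Data.Nat.ListAction using (sum)
open import Data.List.Membership.Propositional using (_∈_)
open import Relation.Nullary using (¬_)
open import Relation.Nullary.Decidable using (⌊_⌋)
open import Relation.Binary.PropositionalEquality using (_≡_)

-- Pointed dags on the vertex set Fin n (edge relation given as a
-- Boolean matrix: E a b ≡ true means there is an edge a → b).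

data Reach⁺ {n : ℕ} (E : Fin n → Fin n → Bool) : Fin n → Fin n → Set where
  edge : ∀ {a b} → E a b ≡ true → Reach⁺ E a b
  more : ∀ {a b c} → E a b ≡ true → Reach⁺ E b c → Reach⁺ E a c

indeg : {n : ℕ} → (Fin n → Fin n → Bool) → Fin n → ℕ
indeg {n} E a = sum (map (λ b → if E b a then 1 else 0) (allFin n))

IsSink : {n : ℕ} → (Fin n → Fin n → Bool) → Fin n → Set
IsSink {n} E a = (b : Fin n) → E a b ≡ false

record PointedDag (n : ℕ) : Set where
  field
    E          : Fin n → Fin n → Bool
    acyclic    : (a : Fin n) → ¬ Reach⁺ E a a
    sink       : Fin n
    sink-sink  : IsSink E sink
    sink-uniq  : (a : Fin n) → IsSink E a → a ≡ sink
    indeg-0-2  : (a : Fin n) → indeg E a ≡ 0 ⊎ indeg E a ≡ 2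

-- Variables x_{a,i} (a a vertex, i ∈ Fin k standing for 1..k),
-- literals (polarity true = positive), clauses as sets of literals.

Var : ℕ → ℕ → Set
Var n k = Fin n × Fin k

Lit : ℕ → ℕ → Set
Lit n k = Var n k × Bool

Clause : ℕ → ℕ → Set
Clause n k = Lit n k → Bool

_≈ᶜ_ : {n k : ℕ} → Clause n k → Clause n k → Set
C ≈ᶜ D = ∀ l → C l ≡ D l

∅ᶜ : {n k : ℕ} → Clause n k
∅ᶜ _ = false

_∪ᶜ_ : {n k : ℕ} → Clause n k → Clause n k → Clause n k
(C ∪ᶜ D) l = C l ∨ D l

_==ˡ_ : {n k : ℕ} → Lit n k → Lit n k → Bool
((a , i) , p) ==ˡ ((b , j) , q) = ⌊ a ≟ᶠ b ⌋ ∧ ⌊ i ≟ᶠ j ⌋ ∧ ⌊ p ≟ᵇ q ⌋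

resolvent : {n k : ℕ} → Clause n k → Clause n k → Var n k → Clause n k
resolvent C D y l = (C l ∧ not (l ==ˡ (y , true))) ∨ (D l ∧ not (l ==ˡ (y , false)))

-- x_a^{k⊕} and x̄_a^{k⊕}.
-- A sign vector s : Fin k → Bool (s j ≡ true  means  i_j = -1) gives the
-- clause x_{a,1}^{i_1} ∨ ... ∨ x_{a,k}^{i_k}.

negCount : {k : ℕ} → (Fin k → Bool) → ℕ
negCount {k} s = sum (map (λ j → if s j then 1 else 0) (allFin k))

signClause : {n k : ℕ} → Fin n → (Fin k → Bool) → Clause n k
signClause a s ((b , j) , p) = ⌊ b ≟ᶠ a ⌋ ∧ ⌊ p ≟ᵇ not (s j) ⌋

ParityOK : {k : ℕ} → Bool → (Fin k → Bool) → Set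
ParityOK true  s = 2 ∣ negCount s
ParityOK false s = ¬ (2 ∣ negCount s)

-- XorSet a true = x_a^{k⊕},  XorSet a false = x̄_a^{k⊕}
XorSet : {n k : ℕ} → Fin n → Bool → Clause n k → Set
XorSet {n} {k} a pol C = Σ (Fin k → Bool) λ s → ParityOK pol s × (C ≈ᶜ signClause a s)

-- E^{k⊕} for a clause E = z_1 ∨ ... ∨ z_ℓ given as a list of
-- (vertex, polarity) pairs: clauses E_1 ∨ ... ∨ E_ℓ with E_i ∈ z_i^{k⊕}.
LiftSet : {n k : ℕ} → List (Fin n × Bool) → Clause n k → Set
LiftSet []             C = C ≈ᶜ ∅ᶜ
LiftSet {n} {k} ((a , p) ∷ E) C =
  Σ (Clause n k) λ C₁ → Σ (Clause n k) λ C₂ →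
    XorSet a p C₁ × LiftSet E C₂ × (C ≈ᶜ (C₁ ∪ᶜ C₂))

-- Dag-like resolution derivations: a sequence of lines
-- 0 .. len, each line an initial clause (from Ax) or the resolvent of
-- two earlier lines on some variable; the last line is the target.

data Step {n k m : ℕ} (Ax : Clause n k → Set) (cl : Fin m → Clause n k) (i : Fin m) : Set where
  axiom   : Ax (cl i) → Step Ax cl i
  resolve : (j l : Fin m) → j <ᶠ i → l <ᶠ i → (y : Var n k) →
            cl j (y , true) ≡ true → cl l (y , false) ≡ true →
            cl i ≈ᶜ resolvent (cl j) (cl l) y → Step Ax cl i

premises : {n k m : ℕ} {Ax : Clause n k → Set} {cl : Fin m → Clause n k} {i : Fin m} →
           Step Ax cl i → List (Fin m × Var n k)
premises (axiom _) = []
premises (resolve j l _ _ y _ _ _) = (j , y) ∷ (l , y) ∷ []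

isRes : {n k m : ℕ} {Ax : Clause n k → Set} {cl : Fin m → Clause n k} {i : Fin m} →
        Step Ax cl i → Bool
isRes (axiom _) = false
isRes (resolve _ _ _ _ _ _ _ _) = true

record Derivation {n k : ℕ} (Ax : Clause n k → Set) (target : Clause n k) : Set₁ where
  field
    len   : ℕ
    cl    : Fin (suc len) → Clause n k
    step  : (i : Fin (suc len)) → Step Ax cl i
    concl : cl (fromℕ len) ≈ᶜ target

  root : Fin (suc len)
  root = fromℕ len

  resCount : ℕ
  resCount = sum (map (λ i → if isRes (step i) then 1 else 0) (allFin (suc len)))

  data PathVars : Fin (suc len) → Fin (suc len) → List (Var n k) → Set where
    stop : ∀ {i} → PathVars i i []
    down : ∀ {i j b y vs} → (j , y) ∈ premises (step i) → PathVars j b vs →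
           PathVars i b (y ∷ vs)

open Derivation public

ResolvesOnlyOn : {n k : ℕ} {Ax : Clause n k → Set} {C : Clause n k} →
                 Derivation Ax C → Fin n → Fin n → Set
ResolvesOnlyOn P u v =
  ∀ i jy → jy ∈ premises (step P i) →
    proj₁ (proj₂ jy) ≡ u ⊎ proj₁ (proj₂ jy) ≡ v

PathsToXorExact : {n k : ℕ} {Ax : Clause n k → Set} {C : Clause n k} →
                  Derivation Ax C → Fin n → Set
PathsToXorExact {n} {k} P v =
  ∀ b → isRes (step P b) ≡ false → XorSet v true (cl P b) →
  ∀ vs → PathVars P (root P) b vs →
    ((y : Var n k) → y ∈ vs → proj₁ y ≡ v) × ((j : Fin k) → (v , j) ∈ vs)

Axioms : {n k : ℕ} → Fin n → Fin n → Fin n → Clause n k → Set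
Axioms u v w C =
  XorSet u true C ⊎ XorSet v true C ⊎
  LiftSet ((u , false) ∷ (v , false) ∷ (w , true) ∷ []) C

module Submission where

-- For odd t, the clause x_v^t ∨ x_w^s is obtained from the
-- 2^k clauses x_u^r (r even) and x_u^r ∨ x_v^t ∨ x_w^s (r odd) by a complete binary
-- tree of resolutions on x_{u,k},…,x_{u,1}: at the bottom the two sign vectors
-- differ in one sign, hence in parity, so exactly one of them carries x_v^t ∨ x_w^s.
-- The same tree on the variables of v turns x_v^t (t even) and x_v^t ∨ x_w^s
-- (t odd) into x_w^s.  This is a tree with fewer than 2^k · 2^k inferences, its
-- pivots are u- and v-variables, and a leaf in x_v^{k⊕} is reached exactly
-- through the outer tree, i.e. through the variables of v.

open import Defs
open import Data.Nat using (ℕ; zero; suc; _+_; _∸_; _<_; _≤_; _^_; _*_; z≤n; s≤s; _≤?_; _<?_)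
open import Data.Nat.Properties
open import Data.Nat.Divisibility using (_∣_; _∣?_; ∣m+n∣m⇒∣n; ∣1⇒≡1)
open import Data.Nat.ListAction using (sum)
open import Data.Fin using (Fin; toℕ; fromℕ; fromℕ<) renaming (zero to fzero; suc to fsuc; _≟_ to _≟ᶠ_)
open import Data.Fin.Properties using (toℕ-fromℕ<; toℕ-fromℕ; toℕ<n; toℕ-injective)
open import Data.Bool using (Bool; true; false; _∧_; _∨_; not; if_then_else_)
open import Data.Bool.Properties using (∧-identityʳ; ∧-zeroʳ; ∨-identityʳ; ∨-idem; ∧-distribʳ-∨; ∨-commutativeMonoid)
  renaming (_≟_ to _≟ᵇ_)
open import Algebra.Bundles using (CommutativeMonoid)
open import Algebra.Properties.CommutativeSemigroup (CommutativeMonoid.commutativeSemigroup ∨-commutativeMonoid)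
  using (interchange)
open import Data.Product using (Σ; _×_; _,_; proj₁; proj₂)
open import Data.Sum using (_⊎_; inj₁; inj₂)
open import Data.Empty using (⊥-elim)
open import Data.Unit using (⊤; tt)
open import Data.List using (List; []; _∷_; _++_; _∷ʳ_; map; allFin; tabulate)
open import Data.List.Properties using (map-tabulate; ++-assoc; ++-identityʳ)
open import Data.List.Membership.Propositional using (_∈_)
open import Data.List.Relation.Unary.Any using (here; there)
open import Relation.Nullary using (¬_; Dec; yes; no)
open import Relation.Binary.Definitions using (tri<; tri≈; tri>)
open import Relation.Nullary.Decidable using (⌊_⌋; isYes≗does; dec-true; dec-false)
open import Relation.Binary.PropositionalEquality
  using (_≡_; _≢_; refl; sym; trans; cong; cong₂; subst; subst₂; module ≡-Reasoning)

⌊⌋-yes : ∀ {A : Set} (d : Dec A) → A → ⌊ d ⌋ ≡ true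
⌊⌋-yes d a = trans (isYes≗does d) (dec-true d a)

⌊⌋-no : ∀ {A : Set} (d : Dec A) → ¬ A → ⌊ d ⌋ ≡ false
⌊⌋-no d ¬a = trans (isYes≗does d) (dec-false d ¬a)

sumBelow : (ℕ → ℕ) → ℕ → ℕ
sumBelow h zero    = 0
sumBelow h (suc N) = h 0 + sumBelow (λ m → h (suc m)) N

sumBelow-+ : ∀ h a b → sumBelow h (a + b) ≡ sumBelow h a + sumBelow (λ m → h (a + m)) b
sumBelow-+ h zero    b = refl
sumBelow-+ h (suc a) b =
  trans (cong (h 0 +_) (sumBelow-+ (λ m → h (suc m)) a b)) (sym (+-assoc (h 0) _ _))

sumBelow-suc : ∀ h N → sumBelow h (suc N) ≡ sumBelow h N + h N
sumBelow-suc h zero    = +-comm (h 0) 0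
sumBelow-suc h (suc N) =
  trans (cong (h 0 +_) (sumBelow-suc (λ m → h (suc m)) N)) (sym (+-assoc (h 0) _ _))

sumBelow-cong : ∀ {h h′} N → (∀ m → m < N → h m ≡ h′ m) → sumBelow h N ≡ sumBelow h′ N
sumBelow-cong zero    eq = refl
sumBelow-cong (suc N) eq =
  cong₂ _+_ (eq 0 (s≤s z≤n)) (sumBelow-cong N (λ m m<N → eq (suc m) (s≤s m<N)))

sum-allFin : ∀ N (g : Fin N → ℕ) (h : ℕ → ℕ) → (∀ i → g i ≡ h (toℕ i)) →
             sum (map g (allFin N)) ≡ sumBelow h N
sum-allFin N g h eq = trans (cong sum (map-tabulate (λ i → i) g)) (sum-tabulate N g h eq)
  where
  sum-tabulate : ∀ N (g : Fin N → ℕ) (h : ℕ → ℕ) → (∀ i → g i ≡ h (toℕ i)) →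
                 sum (tabulate g) ≡ sumBelow h N
  sum-tabulate zero    g h eq = refl
  sum-tabulate (suc N) g h eq =
    cong₂ _+_ (eq fzero) (sum-tabulate N (λ i → g (fsuc i)) (λ m → h (suc m)) (λ i → eq (fsuc i)))

-- Post-order layout of a binary node: line m is line m of the left part if
-- m < a, line m ∸ a of the right part if a ≤ m < a + b, and the node's own
-- line otherwise.
place : {X : Set} → ℕ → ℕ → ℕ → (ℕ → X) → (ℕ → X) → X → X
place m a b left right last with m <? a
... | yes _ = left m
... | no _  with m <? a + b
...   | yes _ = right (m ∸ a)
...   | no _  = last

module _ {X : Set} (a b : ℕ) (left right : ℕ → X) (last : X) where

  place-left : ∀ {m} → m < a → place m a b left right last ≡ left m
  place-left {m} m<a with m <? a
  ... | yes _   = refl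
  ... | no m≮a = ⊥-elim (m≮a m<a)

  place-right : ∀ {m} → m < b → place (a + m) a b left right last ≡ right m
  place-right {m} m<b with a + m <? a
  ... | yes a+m<a = ⊥-elim (<-irrefl refl (≤-<-trans (m≤m+n a m) a+m<a))
  ... | no _ with a + m <? a + b
  ...   | yes _       = cong right (m+n∸m≡n a m)
  ...   | no a+m≮a+b = ⊥-elim (a+m≮a+b (+-monoʳ-< a m<b))

  place-last : place (a + b) a b left right last ≡ last
  place-last with a + b <? a
  ... | yes a+b<a = ⊥-elim (<-irrefl refl (≤-<-trans (m≤m+n a b) a+b<a))
  ... | no _ with a + b <? a + b
  ...   | yes a+b<a+b = ⊥-elim (<-irrefl refl a+b<a+b)
  ...   | no _        = refl

data Region (m a b : ℕ) : Set where
  inLeft  : m < a → Region m a b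
  inRight : ∀ m′ → m′ < b → m ≡ a + m′ → Region m a b
  atLast  : m ≡ a + b → Region m a b

region : ∀ m a b → m < suc (a + b) → Region m a b
region m a b m≤a+b with m <? a
... | yes m<a = inLeft m<a
... | no m≮a with m <? a + b
...   | yes m<a+b = inRight (m ∸ a) (subst (m ∸ a <_) (m+n∸m≡n a b) (∸-monoˡ-< m<a+b (≮⇒≥ m≮a)))
                            (sym (m+[n∸m]≡n (≮⇒≥ m≮a)))
...   | no m≮a+b  = atLast (≤-antisym (≤-pred m≤a+b) (≮⇒≥ m≮a+b))

module TreeProofs {n k : ℕ} (Ax : Clause n k → Set) where

  data Tree : Clause n k → Set where
    leaf : ∀ {C} → Ax C → Tree C
    node : ∀ {C D E} (y : Var n k) → C (y , true) ≡ true → D (y , false) ≡ true →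
           E ≈ᶜ resolvent C D y → Tree C → Tree D → Tree E

  record TreeProof (D : Clause n k) : Set where
    constructor proves
    field
      conclusion : Clause n k
      tree       : Tree conclusion
      sound      : conclusion ≈ᶜ D

  open TreeProof public

  retarget : ∀ {D D′} → TreeProof D → D ≈ᶜ D′ → TreeProof D′
  retarget π D≈D′ = proves (conclusion π) (tree π) (λ l → trans (sound π l) (D≈D′ l))

  inferences : ∀ {C} → Tree C → ℕ
  inferences (leaf _)             = 0
  inferences (node _ _ _ _ t₁ t₂) = inferences t₁ + inferences t₂ + 1

  lastLine : ∀ {C} → Tree C → ℕ
  lastLine (leaf _)             = 0
  lastLine (node _ _ _ _ t₁ t₂) = suc (lastLine t₁) + suc (lastLine t₂)

  size : ∀ {C} → Tree C → ℕ
  size t = suc (lastLine t)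

  data Reason : Set where
    given    : Reason
    resolved : ℕ → ℕ → Var n k → Reason

  shiftReason : ℕ → Reason → Reason
  shiftReason a given            = given
  shiftReason a (resolved j l y) = resolved (a + j) (a + l) y

  isResolved : Reason → ℕ
  isResolved given            = 0
  isResolved (resolved _ _ _) = 1

  -- A line of the layout: its clause, its justification, and its route,
  -- the pivots met on the way from the conclusion of the tree down to it.
  record Line : Set where
    constructor line
    field
      clause : Clause n k
      reason : Reason
      route  : List (Var n k)

  open Line

  under : Var n k → ℕ → Line → Line
  under y a (line C ρ π) = line C (shiftReason a ρ) (y ∷ π)

  lineAt : ∀ {C} → Tree C → ℕ → Line
  lineAt (leaf {C} _) _ = line C given []
  lineAt (node {E = E} y _ _ _ t₁ t₂) m =
    place m (size t₁) (size t₂) (λ m → under y 0 (lineAt t₁ m)) (λ m → under y (size t₁) (lineAt t₂ m))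
          (line E (resolved (lastLine t₁) (size t₁ + lastLine t₂) y) [])

  clauseAt : ∀ {C} → Tree C → ℕ → Clause n k
  clauseAt t m = clause (lineAt t m)

  reasonAt : ∀ {C} → Tree C → ℕ → Reason
  reasonAt t m = reason (lineAt t m)

  routeAt : ∀ {C} → Tree C → ℕ → List (Var n k)
  routeAt t m = route (lineAt t m)

  Embeds : ∀ {C D} → Tree C → ℕ → Var n k → Tree D → Set
  Embeds t a y s = ∀ {x} → x < size s → lineAt t (a + x) ≡ under y a (lineAt s x)

  module NodeLayout {C D E} (y : Var n k) (c : C (y , true) ≡ true) (d : D (y , false) ≡ true)
                    (e : E ≈ᶜ resolvent C D y) (t₁ : Tree C) (t₂ : Tree D) where

    private
      t : Tree E
      t = node y c d e t₁ t₂

    embeds-left : Embeds t 0 y t₁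
    embeds-left = place-left (size t₁) (size t₂) _ _ _

    embeds-right : Embeds t (size t₁) y t₂
    embeds-right = place-right (size t₁) (size t₂) _ _ _

    at-last : lineAt t (lastLine t) ≡ line E (resolved (lastLine t₁) (size t₁ + lastLine t₂) y) []
    at-last = place-last (size t₁) (size t₂) _ _ _

  conclusion-last : ∀ {C} (t : Tree C) → clauseAt t (lastLine t) ≡ C
  conclusion-last (leaf _)             = refl
  conclusion-last (node y c d e t₁ t₂) = cong clause (NodeLayout.at-last y c d e t₁ t₂)

  route-last : ∀ {C} (t : Tree C) → routeAt t (lastLine t) ≡ []
  route-last (leaf _)             = refl
  route-last (node y c d e t₁ t₂) = cong route (NodeLayout.at-last y c d e t₁ t₂)

  shift-given : ∀ a ρ → shiftReason a ρ ≡ given → ρ ≡ given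
  shift-given a given _ = refl
  shift-given a (resolved _ _ _) ()

  shift-resolved : ∀ a ρ {j l y} → shiftReason a ρ ≡ resolved j l y →
                   Σ ℕ λ j′ → Σ ℕ λ l′ → ρ ≡ resolved j′ l′ y × j ≡ a + j′ × l ≡ a + l′
  shift-resolved a given ()
  shift-resolved a (resolved j′ l′ y) refl = j′ , l′ , refl , refl , refl

  Valid : (ℕ → Clause n k) → ℕ → Reason → Set
  Valid cls m given            = Ax (cls m)
  Valid cls m (resolved j l y) =
    j < m × l < m × cls j (y , true) ≡ true × cls l (y , false) ≡ true ×
    cls m ≈ᶜ resolvent (cls j) (cls l) y

  Valid-resolved : ∀ {cls : ℕ → Clause n k} {j l m y C D E} → j < m → l < m →
                   cls j ≡ C → cls l ≡ D → cls m ≡ E →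
                   C (y , true) ≡ true → D (y , false) ≡ true → E ≈ᶜ resolvent C D y →
                   Valid cls m (resolved j l y)
  Valid-resolved j<m l<m refl refl refl c d e = j<m , l<m , c , d , e

  Valid-shift : ∀ {cls cls′ : ℕ → Clause n k} {m} a ρ → (∀ x → x ≤ m → cls′ (a + x) ≡ cls x) →
                Valid cls m ρ → Valid cls′ (a + m) (shiftReason a ρ)
  Valid-shift {m = m} a given agree ax = subst Ax (sym (agree m ≤-refl)) ax
  Valid-shift {cls′ = cls′} {m} a (resolved j l y) agree (j<m , l<m , c , d , e) =
    Valid-resolved {cls = cls′} (+-monoʳ-< a j<m) (+-monoʳ-< a l<m)
      (agree j (<⇒≤ j<m)) (agree l (<⇒≤ l<m)) (agree m ≤-refl) c d e

  Valid-embed : ∀ {C D} (t : Tree C) (s : Tree D) {a y} → Embeds t a y s → ∀ {x} → x < size s →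
                Valid (clauseAt s) x (reasonAt s x) → Valid (clauseAt t) (a + x) (reasonAt t (a + x))
  Valid-embed t s {a} emb {x} x<s valid =
    subst (Valid (clauseAt t) (a + x)) (sym (cong reason (emb x<s)))
      (Valid-shift a (reasonAt s x) (λ z z≤x → cong clause (emb (≤-<-trans z≤x x<s))) valid)

  lineValid : ∀ {C} (t : Tree C) m → m < size t → Valid (clauseAt t) m (reasonAt t m)
  lineValid (leaf ax) m _ = ax
  lineValid t@(node y c d e t₁ t₂) m m<size with region m (size t₁) (size t₂) m<size
  ... | inLeft m<t₁         = Valid-embed t t₁ embeds-left m<t₁ (lineValid t₁ m m<t₁)
    where open NodeLayout y c d e t₁ t₂
  ... | inRight x x<t₂ refl = Valid-embed t t₂ embeds-right x<t₂ (lineValid t₂ x x<t₂)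
    where open NodeLayout y c d e t₁ t₂
  ... | atLast refl =
    subst (Valid (clauseAt t) (lastLine t)) (sym (cong reason at-last))
      (Valid-resolved {cls = clauseAt t} (m≤m+n (size t₁) (size t₂)) (+-monoʳ-< (size t₁) ≤-refl)
        (trans (cong clause (embeds-left ≤-refl)) (conclusion-last t₁))
        (trans (cong clause (embeds-right ≤-refl)) (conclusion-last t₂))
        (cong clause at-last) c d e)
    where open NodeLayout y c d e t₁ t₂

  premises-earlier : ∀ {C} (t : Tree C) m → m < size t → ∀ {j l y} →
                     reasonAt t m ≡ resolved j l y → j < m × l < m
  premises-earlier t m m<size eq with reasonAt t m | lineValid t m m<size
  premises-earlier t m m<size refl | resolved j l y | j<m , l<m , _ = j<m , l<m

  count : ∀ {C} (t : Tree C) → sumBelow (λ m → isResolved (reasonAt t m)) (size t) ≡ inferences t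
  count (leaf _) = refl
  count t@(node y c d e t₁ t₂) = begin
      sumBelow h (suc (size t₁ + size t₂))
    ≡⟨ sumBelow-suc h (size t₁ + size t₂) ⟩
      sumBelow h (size t₁ + size t₂) + h (lastLine t)
    ≡⟨ cong (_+ h (lastLine t)) (sumBelow-+ h (size t₁) (size t₂)) ⟩
      sumBelow h (size t₁) + sumBelow (λ x → h (size t₁ + x)) (size t₂) + h (lastLine t)
    ≡⟨ cong₂ _+_ (cong₂ _+_ (count-embed t₁ embeds-left) (count-embed t₂ embeds-right))
                 (cong (λ L → isResolved (reason L)) at-last) ⟩
      inferences t₁ + inferences t₂ + 1
    ∎
    where
    open ≡-Reasoning
    open NodeLayout y c d e t₁ t₂
    h : ℕ → ℕ
    h m = isResolved (reasonAt t m)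
    isResolved-shift : ∀ a ρ → isResolved (shiftReason a ρ) ≡ isResolved ρ
    isResolved-shift a given            = refl
    isResolved-shift a (resolved _ _ _) = refl
    count-embed : ∀ {D} (s : Tree D) {a} → Embeds t a y s →
                  sumBelow (λ x → h (a + x)) (size s) ≡ inferences s
    count-embed s {a} emb =
      trans (sumBelow-cong (size s) (λ x x<s → trans (cong (λ L → isResolved (reason L)) (emb x<s))
                                                     (isResolved-shift a (reasonAt s x))))
            (count s)

  reason-embed : ∀ {C D} (t : Tree C) (s : Tree D) {a y} → Embeds t a y s → ∀ {x} → x < size s →
                 ∀ {j l z} → reasonAt t (a + x) ≡ resolved j l z →
                 Σ ℕ λ j′ → Σ ℕ λ l′ → reasonAt s x ≡ resolved j′ l′ z × j ≡ a + j′ × l ≡ a + l′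
  reason-embed t s {a} emb {x} x<s eq =
    shift-resolved a (reasonAt s x) (trans (sym (cong reason (emb x<s))) eq)

  given-embed : ∀ {C D} (t : Tree C) (s : Tree D) {a y} → Embeds t a y s → ∀ {x} → x < size s →
                reasonAt t (a + x) ≡ given → reasonAt s x ≡ given
  given-embed t s {a} emb {x} x<s eq = shift-given a (reasonAt s x) (trans (sym (cong reason (emb x<s))) eq)

  AllPivots : (Var n k → Set) → ∀ {C} → Tree C → Set
  AllPivots P (leaf _)             = ⊤
  AllPivots P (node y _ _ _ t₁ t₂) = P y × AllPivots P t₁ × AllPivots P t₂

  pivotAt : ∀ P {C} (t : Tree C) → AllPivots P t → ∀ m → m < size t → ∀ {j l y} →
            reasonAt t m ≡ resolved j l y → P y
  pivotAt P (leaf _) _ m _ ()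
  pivotAt P t@(node y c d e t₁ t₂) (P-y , P₁ , P₂) m m<size eq with region m (size t₁) (size t₂) m<size
  ... | inLeft m<t₁ =
    let _ , _ , eq₁ , _ = reason-embed t t₁ (NodeLayout.embeds-left y c d e t₁ t₂) m<t₁ eq
    in pivotAt P t₁ P₁ m m<t₁ eq₁
  ... | inRight x x<t₂ refl =
    let _ , _ , eq₂ , _ = reason-embed t t₂ (NodeLayout.embeds-right y c d e t₁ t₂) x<t₂ eq
    in pivotAt P t₂ P₂ x x<t₂ eq₂
  ... | atLast refl with trans (sym (cong reason (NodeLayout.at-last y c d e t₁ t₂))) eq
  ...   | refl = P-y

  LeafCondition : Set₁
  LeafCondition = Clause n k → List (Var n k) → Set

  _below_ : LeafCondition → Var n k → LeafCondition
  (Q below y) C vs = Q C (y ∷ vs)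

  LeavesSatisfy : LeafCondition → ∀ {C} → Tree C → Set
  LeavesSatisfy Q (leaf {C} _)         = Q C []
  LeavesSatisfy Q (node y _ _ _ t₁ t₂) = LeavesSatisfy (Q below y) t₁ × LeavesSatisfy (Q below y) t₂

  LeavesSatisfy-mono : ∀ {C} (t : Tree C) {Q Q′ : LeafCondition} → (∀ C vs → Q C vs → Q′ C vs) →
                       LeavesSatisfy Q t → LeavesSatisfy Q′ t
  LeavesSatisfy-mono (leaf _) Q⇒Q′ q = Q⇒Q′ _ [] q
  LeavesSatisfy-mono (node y _ _ _ t₁ t₂) Q⇒Q′ (q₁ , q₂) =
    LeavesSatisfy-mono t₁ (λ C vs → Q⇒Q′ C (y ∷ vs)) q₁ , LeavesSatisfy-mono t₂ (λ C vs → Q⇒Q′ C (y ∷ vs)) q₂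

  leafAt : ∀ Q {C} (t : Tree C) → LeavesSatisfy Q t → ∀ m → m < size t →
           reasonAt t m ≡ given → Q (clauseAt t m) (routeAt t m)
  leafAt Q (leaf _) q m _ _ = q
  leafAt Q t@(node y c d e t₁ t₂) (q₁ , q₂) m m<size eq with region m (size t₁) (size t₂) m<size
  ... | inLeft m<t₁ =
    subst (λ L → Q (clause L) (route L)) (sym (embeds-left m<t₁))
      (leafAt (Q below y) t₁ q₁ m m<t₁ (given-embed t t₁ embeds-left m<t₁ eq))
    where open NodeLayout y c d e t₁ t₂
  ... | inRight x x<t₂ refl =
    subst (λ L → Q (clause L) (route L)) (sym (embeds-right x<t₂))
      (leafAt (Q below y) t₂ q₂ x x<t₂ (given-embed t t₂ embeds-right x<t₂ eq))
    where open NodeLayout y c d e t₁ t₂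
  ... | atLast refl with trans (sym (cong reason (NodeLayout.at-last y c d e t₁ t₂))) eq
  ...   | ()

  RouteStep : ∀ {C} → Tree C → ℕ → Set
  RouteStep t m = ∀ {j l y} → reasonAt t m ≡ resolved j l y →
                  routeAt t j ≡ routeAt t m ∷ʳ y × routeAt t l ≡ routeAt t m ∷ʳ y

  routeStep-embed : ∀ {C D} (t : Tree C) (s : Tree D) {a y} → Embeds t a y s → ∀ {x} → x < size s →
                    RouteStep s x → RouteStep t (a + x)
  routeStep-embed t s {a} {y} emb {x} x<s step-s eq with reason-embed t s emb x<s eq
  ... | j′ , l′ , eq′ , refl , refl =
    let j′<x , l′<x = premises-earlier s x x<s eq′
        route-j , route-l = step-s eq′
    in lift j′ (<-trans j′<x x<s) route-j , lift l′ (<-trans l′<x x<s) route-l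
    where
    lift : ∀ i → i < size s → ∀ {z} → routeAt s i ≡ routeAt s x ∷ʳ z →
           routeAt t (a + i) ≡ routeAt t (a + x) ∷ʳ z
    lift i i<s {z} route-i = begin
        routeAt t (a + i)          ≡⟨ cong route (emb i<s) ⟩
        y ∷ routeAt s i            ≡⟨ cong (y ∷_) route-i ⟩
        (y ∷ routeAt s x) ∷ʳ z     ≡⟨ cong (λ L → route L ∷ʳ z) (sym (emb x<s)) ⟩
        routeAt t (a + x) ∷ʳ z     ∎
      where open ≡-Reasoning

  routeStep : ∀ {C} (t : Tree C) m → m < size t → RouteStep t m
  routeStep (leaf _) m _ ()
  routeStep t@(node y c d e t₁ t₂) m m<size with region m (size t₁) (size t₂) m<size
  ... | inLeft m<t₁         = routeStep-embed t t₁ embeds-left m<t₁ (routeStep t₁ m m<t₁)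
    where open NodeLayout y c d e t₁ t₂
  ... | inRight x x<t₂ refl = routeStep-embed t t₂ embeds-right x<t₂ (routeStep t₂ x x<t₂)
    where open NodeLayout y c d e t₁ t₂
  ... | atLast refl = λ eq → root-step (trans (sym (cong reason at-last)) eq)
    where
    open NodeLayout y c d e t₁ t₂
    root-step : ∀ {j l z} → resolved (lastLine t₁) (size t₁ + lastLine t₂) y ≡ resolved j l z →
                routeAt t j ≡ routeAt t (lastLine t) ∷ʳ z × routeAt t l ≡ routeAt t (lastLine t) ∷ʳ z
    root-step {z = z} refl =
      trans (trans (cong route (embeds-left ≤-refl)) (cong (y ∷_) (route-last t₁))) from-root ,
      trans (trans (cong route (embeds-right ≤-refl)) (cong (y ∷_) (route-last t₂))) from-root
      where
      from-root : [] ∷ʳ z ≡ routeAt t (lastLine t) ∷ʳ z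
      from-root = cong (_∷ʳ z) (sym (route-last t))

  resolveStep : ∀ {N} (cls : ℕ → Clause n k) (i j l : Fin N) y →
                Valid cls (toℕ i) (resolved (toℕ j) (toℕ l) y) → Step Ax (λ i → cls (toℕ i)) i
  resolveStep cls i j l y (j<i , l<i , c , d , e) = resolve j l j<i l<i y c d e

  toStep : ∀ {C} (t : Tree C) (i : Fin (size t)) ρ → Valid (clauseAt t) (toℕ i) ρ →
           Step Ax (λ i → clauseAt t (toℕ i)) i
  toStep t i given            ax    = axiom ax
  toStep t i (resolved j l y) valid =
    resolveStep (clauseAt t) i (fromℕ< j<size) (fromℕ< l<size) y
      (subst₂ (λ j l → Valid (clauseAt t) (toℕ i) (resolved j l y))
              (sym (toℕ-fromℕ< j<size)) (sym (toℕ-fromℕ< l<size)) valid)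
    where
    j<size = <-trans (proj₁ valid) (toℕ<n i)
    l<size = <-trans (proj₁ (proj₂ valid)) (toℕ<n i)

  toStep-isRes : ∀ {C} (t : Tree C) i ρ valid → (if isRes (toStep t i ρ valid) then 1 else 0) ≡ isResolved ρ
  toStep-isRes t i given            _ = refl
  toStep-isRes t i (resolved _ _ _) _ = refl

  toStep-axiom : ∀ {C} (t : Tree C) i ρ valid → isRes (toStep t i ρ valid) ≡ false → ρ ≡ given
  toStep-axiom t i given            _ _  = refl
  toStep-axiom t i (resolved _ _ _) _ ()

  toStep-premise : ∀ {C} (t : Tree C) i ρ valid {j y} → (j , y) ∈ premises (toStep t i ρ valid) →
                   Σ ℕ λ j′ → Σ ℕ λ l′ → ρ ≡ resolved j′ l′ y × (toℕ j ≡ j′ ⊎ toℕ j ≡ l′)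
  toStep-premise t i given _ ()
  toStep-premise t i (resolved j′ l′ y) _ (here refl)         = j′ , l′ , refl , inj₁ (toℕ-fromℕ< _)
  toStep-premise t i (resolved j′ l′ y) _ (there (here refl)) = j′ , l′ , refl , inj₂ (toℕ-fromℕ< _)
  toStep-premise t i (resolved j′ l′ y) _ (there (there ()))

  toDerivation : ∀ {D} → TreeProof D → Derivation Ax D
  toDerivation (proves C t C≈D) = record
    { len   = lastLine t
    ; cl    = λ i → clauseAt t (toℕ i)
    ; step  = λ i → toStep t i (reasonAt t (toℕ i)) (lineValid t (toℕ i) (toℕ<n i))
    ; concl = λ l → trans (cong (λ m → clauseAt t m l) (toℕ-fromℕ (lastLine t)))
                          (trans (cong (λ X → X l) (conclusion-last t)) (C≈D l))
    }

  module _ {D} (π : TreeProof D) where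

    private
      t = tree π
      P = toDerivation π

    resCount-toDerivation : resCount P ≡ inferences t
    resCount-toDerivation =
      trans (sum-allFin (size t) _ (λ m → isResolved (reasonAt t m)) (λ i → toStep-isRes t i _ _)) (count t)

    pivots-toDerivation : ∀ Piv → AllPivots Piv t →
                          ∀ i (jy : Fin (size t) × Var n k) → jy ∈ premises (step P i) → Piv (proj₂ jy)
    pivots-toDerivation Piv all i (j , y) mem =
      let _ , _ , eq , _ = toStep-premise t i _ _ mem in pivotAt Piv t all (toℕ i) (toℕ<n i) eq

    route-toDerivation : ∀ {i b vs} → PathVars P i b vs → routeAt t (toℕ b) ≡ routeAt t (toℕ i) ++ vs
    route-toDerivation stop = sym (++-identityʳ _)
    route-toDerivation {i} {b} (down {j = j} {y = y} {vs = vs} mem path) with toStep-premise t i _ _ mem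
    ... | j′ , l′ , eq , j≡ = begin
        routeAt t (toℕ b)                    ≡⟨ route-toDerivation path ⟩
        routeAt t (toℕ j) ++ vs              ≡⟨ cong (_++ vs) (premise-route j≡) ⟩
        (routeAt t (toℕ i) ∷ʳ y) ++ vs       ≡⟨ ++-assoc (routeAt t (toℕ i)) (y ∷ []) vs ⟩
        routeAt t (toℕ i) ++ y ∷ vs          ∎
      where
      open ≡-Reasoning
      premise-route : toℕ j ≡ j′ ⊎ toℕ j ≡ l′ → routeAt t (toℕ j) ≡ routeAt t (toℕ i) ∷ʳ y
      premise-route (inj₁ refl) = proj₁ (routeStep t (toℕ i) (toℕ<n i) eq)
      premise-route (inj₂ refl) = proj₂ (routeStep t (toℕ i) (toℕ<n i) eq)

    leaves-toDerivation : ∀ Q → LeavesSatisfy Q t → ∀ b → isRes (step P b) ≡ false →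
                          ∀ vs → PathVars P (root P) b vs → Q (cl P b) vs
    leaves-toDerivation Q leaves b initial vs path =
      subst (Q (cl P b)) vs≡route
        (leafAt Q t leaves (toℕ b) (toℕ<n b) (toStep-axiom t b _ _ initial))
      where
      vs≡route : routeAt t (toℕ b) ≡ vs
      vs≡route = begin
        routeAt t (toℕ b)                        ≡⟨ route-toDerivation path ⟩
        routeAt t (toℕ (fromℕ (lastLine t))) ++ vs ≡⟨ cong (λ m → routeAt t m ++ vs) (toℕ-fromℕ (lastLine t)) ⟩
        routeAt t (lastLine t) ++ vs             ≡⟨ cong (_++ vs) (route-last t) ⟩
        vs                                       ∎
        where open ≡-Reasoning

-- Sign vectors: t j ≡ true means that x_{a,j} occurs negated in x_a^t.
Sign : ℕ → Set
Sign k = Fin k → Bool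

Even : ∀ {k} → Sign k → Set
Even t = 2 ∣ negCount t

even? : ∀ {k} (t : Sign k) → Dec (Even t)
even? t = 2 ∣? negCount t

setSign : ∀ {k} → Sign k → ℕ → Bool → Sign k
setSign t r b j = if ⌊ toℕ j ≟ r ⌋ then b else t j

negCount-flip : ∀ {k} (t : Sign (suc k)) → negCount (setSign t 0 true) ≡ suc (negCount (setSign t 0 false))
negCount-flip {k} t =
  cong suc (trans (cong sum (map-tabulate fsuc (negs true))) (sym (cong sum (map-tabulate fsuc (negs false)))))
  where
  negs : Bool → Fin (suc k) → ℕ
  negs b j = if setSign t 0 b j then 1 else 0

opposite-parity : ∀ {k} (t : Sign (suc k)) → Even (setSign t 0 false) → ¬ Even (setSign t 0 true)
opposite-parity t even₀ even₁ = 2≢1 (∣1⇒≡1 (∣m+n∣m⇒∣n 2∣n+1 even₀))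
  where
  2≢1 : 2 ≢ 1
  2≢1 ()
  2∣n+1 : 2 ∣ negCount (setSign t 0 false) + 1
  2∣n+1 = subst (2 ∣_) (trans (negCount-flip t) (+-comm 1 _)) even₁

Avoids : ∀ {n k} → Var n k → Clause n k → Set
Avoids y R = ∀ p → R (y , p) ≡ false

FreeOf : ∀ {n k} → Fin n → Clause n k → Set
FreeOf a R = ∀ j → Avoids (a , j) R

FreeOf-∪ : ∀ {n k} {a : Fin n} {R R′ : Clause n k} → FreeOf a R → FreeOf a R′ → FreeOf a (R ∪ᶜ R′)
FreeOf-∪ free free′ j p = cong₂ _∨_ (free j p) (free′ j p)

==ˡ-sound : ∀ {n k} (l l′ : Lit n k) → l ==ˡ l′ ≡ true → l ≡ l′
==ˡ-sound ((a , i) , p) ((b , j) , q) eq with a ≟ᶠ b | i ≟ᶠ j | p ≟ᵇ q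
==ˡ-sound ((a , i) , p) ((b , j) , q) eq | yes refl | yes refl | yes refl = refl
==ˡ-sound ((a , i) , p) ((b , j) , q) () | no _     | _        | _
==ˡ-sound ((a , i) , p) ((b , j) , q) () | yes _    | no _     | _
==ˡ-sound ((a , i) , p) ((b , j) , q) () | yes _    | yes _    | no _

resolvent-cong : ∀ {n k} {C C′ D D′ : Clause n k} (y : Var n k) →
                 C ≈ᶜ C′ → D ≈ᶜ D′ → resolvent C D y ≈ᶜ resolvent C′ D′ y
resolvent-cong y C≈C′ D≈D′ l =
  cong₂ (λ c d → (c ∧ not (l ==ˡ (y , true))) ∨ (d ∧ not (l ==ˡ (y , false)))) (C≈C′ l) (D≈D′ l)

drop-guard : ∀ {n k} {R : Clause n k} {y} q → Avoids y R → ∀ l → R l ∧ not (l ==ˡ (y , q)) ≡ R l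
drop-guard {R = R} {y} q avoids l with l ==ˡ (y , q) in eq
... | false = ∧-identityʳ (R l)
... | true  = trans (∧-zeroʳ (R l))
                    (sym (subst (λ m → R m ≡ false) (sym (==ˡ-sound l (y , q) eq)) (avoids q)))

resolvent-∪ : ∀ {n k} {X₀ X₁ R₀ R₁ : Clause n k} (y : Var n k) → Avoids y R₀ → Avoids y R₁ →
              resolvent (X₀ ∪ᶜ R₀) (X₁ ∪ᶜ R₁) y ≈ᶜ (resolvent X₀ X₁ y ∪ᶜ (R₀ ∪ᶜ R₁))
resolvent-∪ {X₀ = X₀} {X₁} {R₀} {R₁} y avoids₀ avoids₁ l = begin
    (X₀ l ∨ R₀ l) ∧ g₀ ∨ (X₁ l ∨ R₁ l) ∧ g₁
  ≡⟨ cong₂ _∨_ (∧-distribʳ-∨ g₀ (X₀ l) (R₀ l)) (∧-distribʳ-∨ g₁ (X₁ l) (R₁ l)) ⟩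
    (X₀ l ∧ g₀ ∨ R₀ l ∧ g₀) ∨ (X₁ l ∧ g₁ ∨ R₁ l ∧ g₁)
  ≡⟨ cong₂ _∨_ (cong (X₀ l ∧ g₀ ∨_) (drop-guard true avoids₀ l))
               (cong (X₁ l ∧ g₁ ∨_) (drop-guard false avoids₁ l)) ⟩
    (X₀ l ∧ g₀ ∨ R₀ l) ∨ (X₁ l ∧ g₁ ∨ R₁ l)
  ≡⟨ interchange (X₀ l ∧ g₀) (R₀ l) (X₁ l ∧ g₁) (R₁ l) ⟩
    (X₀ l ∧ g₀ ∨ X₁ l ∧ g₁) ∨ (R₀ l ∨ R₁ l)
  ∎
  where
  open ≡-Reasoning
  g₀ = not (l ==ˡ (y , true))
  g₁ = not (l ==ˡ (y , false))

signClause-own : ∀ {n k} (a : Fin n) (t : Sign k) j → signClause a t ((a , j) , not (t j)) ≡ true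
signClause-own a t j rewrite ⌊⌋-yes (a ≟ᶠ a) refl | ⌊⌋-yes (not (t j) ≟ᵇ not (t j)) refl = refl

signClause-free : ∀ {n k} {a b : Fin n} (t : Sign k) → b ≢ a → FreeOf b (signClause a t)
signClause-free {a = a} {b} t b≢a j p rewrite ⌊⌋-no (b ≟ᶠ a) b≢a = refl

signClause-xor : ∀ {n k} (a : Fin n) {p} {t : Sign k} → ParityOK p t → XorSet a p (signClause a t)
signClause-xor a {t = t} parity = t , parity , λ _ → refl

XorSet-vertex : ∀ {n k} {a b : Fin n} {p} {C : Clause n k} → XorSet a p C →
                ∀ {j q} → C ((b , j) , q) ≡ true → b ≡ a
XorSet-vertex {a = a} {b} (t , _ , C≈) {j} {q} in-C with b ≟ᶠ a
... | yes b≡a = b≡a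
... | no b≢a with trans (sym in-C) (trans (C≈ _) (signClause-free t b≢a j q))
...   | ()

-- The literals x_{a,j}^{t_j} of x_a^t with r ≤ j: what is left of x_a^t once
-- the variables x_{a,j} with j < r have been resolved away.
signSuffix : ∀ {n k} → Fin n → ℕ → Sign k → Clause n k
signSuffix a r t ((b , j) , p) = ⌊ b ≟ᶠ a ⌋ ∧ ⌊ r ≤? toℕ j ⌋ ∧ ⌊ p ≟ᵇ not (t j) ⌋

signSuffix-all : ∀ {n k} (a : Fin n) (t : Sign k) → signSuffix a k t ≈ᶜ ∅ᶜ
signSuffix-all a t ((b , j) , p) with b ≟ᶠ a
... | no _  = refl
... | yes _ rewrite ⌊⌋-no (_ ≤? toℕ j) (<⇒≱ (toℕ<n j)) = refl

signSuffix-pivot : ∀ {n k} (a : Fin n) r (t : Sign k) j b → toℕ j ≡ r →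
                   signSuffix a r (setSign t r b) ((a , j) , not b) ≡ true
signSuffix-pivot a r t j b j≡r
  rewrite ⌊⌋-yes (a ≟ᶠ a) refl | ⌊⌋-yes (r ≤? toℕ j) (≤-reflexive (sym j≡r)) | ⌊⌋-yes (toℕ j ≟ r) j≡r
        | ⌊⌋-yes (not b ≟ᵇ not b) refl = refl

signSuffix-resolve : ∀ {n k} (a : Fin n) r (t : Sign k) j₀ → toℕ j₀ ≡ r →
                     signSuffix a (suc r) t ≈ᶜ
                     resolvent (signSuffix a r (setSign t r false)) (signSuffix a r (setSign t r true)) (a , j₀)
signSuffix-resolve a r t j₀ j₀≡r ((b , j) , p) with b ≟ᶠ a
... | no _ = refl
... | yes refl with <-cmp (toℕ j) r
...   | tri< j<r _ _
        rewrite ⌊⌋-no (suc r ≤? toℕ j) (<⇒≱ (<-trans j<r (n<1+n r))) | ⌊⌋-no (r ≤? toℕ j) (<⇒≱ j<r) = refl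
...   | tri≈ _ j≡r _
        rewrite ⌊⌋-no (suc r ≤? toℕ j) (<-irrefl (sym j≡r))
              | ⌊⌋-yes (r ≤? toℕ j) (≤-reflexive (sym j≡r)) | ⌊⌋-yes (toℕ j ≟ r) j≡r
              | ⌊⌋-yes (j ≟ᶠ j₀) (toℕ-injective (trans j≡r (sym j₀≡r))) with p
...     | true  = refl
...     | false = refl
signSuffix-resolve a r t j₀ j₀≡r ((b , j) , p) | yes refl | tri> _ j≢r r<j
  rewrite ⌊⌋-yes (suc r ≤? toℕ j) r<j | ⌊⌋-yes (r ≤? toℕ j) (<⇒≤ r<j) | ⌊⌋-no (toℕ j ≟ r) j≢r
        | ⌊⌋-no (j ≟ᶠ j₀) (λ e → j≢r (trans (cong toℕ e) j₀≡r)) =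
  let x = ⌊ p ≟ᵇ not (t j) ⌋ in trans (sym (∨-idem x)) (sym (cong₂ _∨_ (∧-identityʳ x) (∧-identityʳ x)))

oddPart : ∀ {n k} {A : Set} → Dec A → Clause n k → Clause n k
oddPart (yes _) R = ∅ᶜ
oddPart (no _)  R = R

oddPart-free : ∀ {n k} {A : Set} (d : Dec A) {a : Fin n} {R : Clause n k} → FreeOf a R → FreeOf a (oddPart d R)
oddPart-free (yes _) free j p = refl
oddPart-free (no _)  free j p = free j p

-- Of two sign vectors differing only in the first sign exactly one is odd,
-- so together they carry R once.
oddPart-split : ∀ {n k} (R : Clause n (suc k)) (t : Sign (suc k)) →
                (oddPart (even? (setSign t 0 false)) R ∪ᶜ oddPart (even? (setSign t 0 true)) R) ≈ᶜ R
oddPart-split R t l with even? (setSign t 0 false) | even? (setSign t 0 true)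
... | yes even₀ | yes even₁ = ⊥-elim (opposite-parity t even₀ even₁)
... | yes _     | no _      = refl
... | no _      | yes _     = ∨-identityʳ (R l)
... | no _      | no _      = ∨-idem (R l)

-- Given the clauses
-- x_a^t for even t as initial clauses and proofs of x_a^t ∨ R for odd t, where
-- R does not mention a, a complete binary tree of resolutions on the
-- variables of a derives R.  At level r the tree for t derives the suffix of
-- x_a^t from r on, together with R (or, at level 0, with R only if t is odd).
module Block {n k : ℕ} (Ax : Clause n (suc k) → Set) (a : Fin n)
             (R : Clause n (suc k)) (R-free : FreeOf a R)
             (evenLeaf : ∀ t → Even t → Ax (signClause a t))
             (oddLeaf : ∀ t → ¬ Even t → TreeProofs.TreeProof Ax (signClause a t ∪ᶜ R)) where

  open TreeProofs Ax

  residual : ℕ → Sign (suc k) → Clause n (suc k)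
  residual zero    t = oddPart (even? t) R
  residual (suc r) t = R

  residual-free : ∀ r t → FreeOf a (residual r t)
  residual-free zero    t = oddPart-free (even? t) R-free
  residual-free (suc r) t = R-free

  residual-split : ∀ r t → (residual r (setSign t r false) ∪ᶜ residual r (setSign t r true)) ≈ᶜ R
  residual-split zero    t l = oddPart-split R t l
  residual-split (suc r) t l = ∨-idem (R l)

  leafStage : ∀ t (d : Dec (Even t)) → TreeProof (signSuffix a 0 t ∪ᶜ oddPart d R)
  leafStage t (yes even) = proves (signClause a t) (leaf (evenLeaf t even)) (λ l → sym (∨-identityʳ _))
  leafStage t (no odd)   = oddLeaf t odd

  stage : ∀ r → r ≤ suc k → ∀ t → TreeProof (signSuffix a r t ∪ᶜ residual r t)
  stage zero    _   t = leafStage t (even? t)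
  stage (suc r) r<k t =
    proves _ (node (a , j) pivot₀ pivot₁ resolves (tree S₀) (tree S₁)) (λ _ → refl)
    where
    j  = fromℕ< r<k
    t₀ = setSign t r false
    t₁ = setSign t r true
    S₀ = stage r (<⇒≤ r<k) t₀
    S₁ = stage r (<⇒≤ r<k) t₁
    pivot₀ : conclusion S₀ ((a , j) , true) ≡ true
    pivot₀ = trans (sound S₀ _) (cong (_∨ residual r t₀ ((a , j) , true))
                                      (signSuffix-pivot a r t j false (toℕ-fromℕ< r<k)))
    pivot₁ : conclusion S₁ ((a , j) , false) ≡ true
    pivot₁ = trans (sound S₁ _) (cong (_∨ residual r t₁ ((a , j) , false))
                                      (signSuffix-pivot a r t j true (toℕ-fromℕ< r<k)))
    resolves : (signSuffix a (suc r) t ∪ᶜ R) ≈ᶜ resolvent (conclusion S₀) (conclusion S₁) (a , j)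
    resolves l = begin
        signSuffix a (suc r) t l ∨ R l
      ≡⟨ cong₂ _∨_ (signSuffix-resolve a r t j (toℕ-fromℕ< r<k) l) (sym (residual-split r t l)) ⟩
        resolvent (signSuffix a r t₀) (signSuffix a r t₁) (a , j) l ∨ (residual r t₀ l ∨ residual r t₁ l)
      ≡⟨ sym (resolvent-∪ {X₀ = signSuffix a r t₀} {signSuffix a r t₁} {residual r t₀} {residual r t₁}
                          (a , j) (residual-free r t₀ j) (residual-free r t₁ j) l) ⟩
        resolvent (signSuffix a r t₀ ∪ᶜ residual r t₀) (signSuffix a r t₁ ∪ᶜ residual r t₁) (a , j) l
      ≡⟨ resolvent-cong (a , j) (λ l → sym (sound S₀ l)) (λ l → sym (sound S₁ l)) l ⟩
        resolvent (conclusion S₀) (conclusion S₁) (a , j) l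
      ∎
      where open ≡-Reasoning

  -- At stage k nothing of x_a^t is left.
  derived : TreeProof R
  derived = retarget (stage (suc k) ≤-refl (λ _ → false)) (λ l → cong (_∨ R l) (signSuffix-all a _ l))

  stage-size : ∀ M → 1 ≤ M → (∀ t odd → suc (inferences (tree (oddLeaf t odd))) ≤ M) →
               ∀ r r≤k t → suc (inferences (tree (stage r r≤k t))) ≤ 2 ^ r * M
  stage-size M 1≤M odd-size zero _ t = subst (_ ≤_) (sym (+-identityʳ M)) (leaf-size (even? t))
    where
    leaf-size : (d : Dec (Even t)) → suc (inferences (tree (leafStage t d))) ≤ M
    leaf-size (yes _)  = 1≤M
    leaf-size (no odd) = odd-size t odd
  stage-size M 1≤M odd-size (suc r) r<k t = begin
      suc (i₀ + i₁ + 1)       ≡⟨ cong suc (trans (+-assoc i₀ i₁ 1) (cong (i₀ +_) (+-comm i₁ 1))) ⟩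
      suc i₀ + suc i₁         ≤⟨ +-mono-≤ (stage-size M 1≤M odd-size r _ _) (stage-size M 1≤M odd-size r _ _) ⟩
      2 ^ r * M + 2 ^ r * M   ≡⟨ cong (2 ^ r * M +_) (sym (+-identityʳ (2 ^ r * M))) ⟩
      2 * (2 ^ r * M)         ≡⟨ sym (*-assoc 2 (2 ^ r) M) ⟩
      2 ^ suc r * M           ∎
    where
    open ≤-Reasoning
    i₀ = inferences (tree (stage r (<⇒≤ r<k) (setSign t r false)))
    i₁ = inferences (tree (stage r (<⇒≤ r<k) (setSign t r true)))

  derived-size : ∀ M → 1 ≤ M → (∀ t odd → suc (inferences (tree (oddLeaf t odd))) ≤ M) →
                 suc (inferences (tree derived)) ≤ 2 ^ suc k * M
  derived-size M 1≤M odd-size = stage-size M 1≤M odd-size (suc k) ≤-refl _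

  stage-pivots : ∀ P → (∀ j → P (a , j)) → (∀ t odd → AllPivots P (tree (oddLeaf t odd))) →
                 ∀ r r≤k t → AllPivots P (tree (stage r r≤k t))
  stage-pivots P P-a odd-pivots zero _ t = leaf-pivots (even? t)
    where
    leaf-pivots : (d : Dec (Even t)) → AllPivots P (tree (leafStage t d))
    leaf-pivots (yes _)  = tt
    leaf-pivots (no odd) = odd-pivots t odd
  stage-pivots P P-a odd-pivots (suc r) r<k t =
    P-a _ , stage-pivots P P-a odd-pivots r _ _ , stage-pivots P P-a odd-pivots r _ _

  derived-pivots : ∀ P → (∀ j → P (a , j)) → (∀ t odd → AllPivots P (tree (oddLeaf t odd))) →
                   AllPivots P (tree derived)
  derived-pivots P P-a odd-pivots = stage-pivots P P-a odd-pivots (suc k) ≤-refl _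

  stage-leaves : (Q : ℕ → LeafCondition) →
                 (∀ t → Even t → Q 0 (signClause a t) []) →
                 (∀ t odd → LeavesSatisfy (Q 0) (tree (oddLeaf t odd))) →
                 (∀ r (r<k : r < suc k) C vs → Q r C vs → Q (suc r) C ((a , fromℕ< r<k) ∷ vs)) →
                 ∀ r r≤k t → LeavesSatisfy (Q r) (tree (stage r r≤k t))
  stage-leaves Q even-leaves odd-leaves next zero _ t = leaf-leaves (even? t)
    where
    leaf-leaves : (d : Dec (Even t)) → LeavesSatisfy (Q 0) (tree (leafStage t d))
    leaf-leaves (yes even) = even-leaves t even
    leaf-leaves (no odd)   = odd-leaves t odd
  stage-leaves Q even-leaves odd-leaves next (suc r) r<k t =
    LeavesSatisfy-mono (tree (stage r _ _)) (next r r<k) (stage-leaves Q even-leaves odd-leaves next r _ _) ,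
    LeavesSatisfy-mono (tree (stage r _ _)) (next r r<k) (stage-leaves Q even-leaves odd-leaves next r _ _)

  derived-leaves : (Q : ℕ → LeafCondition) →
                   (∀ t → Even t → Q 0 (signClause a t) []) →
                   (∀ t odd → LeavesSatisfy (Q 0) (tree (oddLeaf t odd))) →
                   (∀ r (r<k : r < suc k) C vs → Q r C vs → Q (suc r) C ((a , fromℕ< r<k) ∷ vs)) →
                   LeavesSatisfy (Q (suc k)) (tree derived)
  derived-leaves Q even-leaves odd-leaves next = stage-leaves Q even-leaves odd-leaves next (suc k) ≤-refl _

lift₃ : ∀ {n k} {a₁ a₂ a₃ : Fin n} {p₁ p₂ p₃} {C₁ C₂ C₃ : Clause n k} →
        XorSet a₁ p₁ C₁ → XorSet a₂ p₂ C₂ → XorSet a₃ p₃ C₃ →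
        LiftSet ((a₁ , p₁) ∷ (a₂ , p₂) ∷ (a₃ , p₃) ∷ []) (C₁ ∪ᶜ (C₂ ∪ᶜ C₃))
lift₃ x₁ x₂ x₃ =
  _ , _ , x₁ , (_ , _ , x₂ , (_ , ∅ᶜ , x₃ , (λ _ → refl) , (λ _ → sym (∨-identityʳ _))) , (λ _ → refl)) ,
  (λ _ → refl)

edge-distinct : ∀ {n} (G : PointedDag n) {a b} → PointedDag.E G a b ≡ true → a ≢ b
edge-distinct G a→b refl = PointedDag.acyclic G _ (edge a→b)

module Construction {n k : ℕ} (u v w : Fin n) (u≢v : u ≢ v) (u≢w : u ≢ w) (v≢w : v ≢ w)
                    (s : Sign (suc k)) (s-even : Even s) where

  open TreeProofs (Axioms {k = suc k} u v w)

  target : Clause n (suc k)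
  target = signClause w s

  module ViaU (t : Sign (suc k)) (t-odd : ¬ Even t) =
    Block (Axioms u v w) u (signClause v t ∪ᶜ target)
      (FreeOf-∪ {R = signClause v t} {target} (signClause-free t u≢v) (signClause-free s u≢w))
      (λ r r-even → inj₁ (signClause-xor u r-even))
      (λ r r-odd → proves _ (leaf (inj₂ (inj₂ (lift₃ (signClause-xor u r-odd) (signClause-xor v t-odd)
                                                      (signClause-xor w s-even))))) (λ _ → refl))

  module ViaV =
    Block (Axioms u v w) v target (signClause-free s v≢w)
      (λ t t-even → inj₂ (inj₁ (signClause-xor v t-even))) ViaU.derived

  proof : TreeProof target
  proof = ViaV.derived

  -- Fewer than 2^k · 2^k inferences: the outer tree has 2^k leaves, each with
  -- fewer than 2^k inferences.
  proof-size : suc (inferences (tree proof)) ≤ 2 ^ (2 * suc k)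
  proof-size = subst (suc (inferences (tree proof)) ≤_) (sym square)
    (ViaV.derived-size (2 ^ suc k) (m^n>0 2 (suc k))
      (λ t t-odd → subst (suc (inferences (tree (ViaU.derived t t-odd))) ≤_) (*-identityʳ (2 ^ suc k))
                         (ViaU.derived-size t t-odd 1 ≤-refl (λ _ _ → ≤-refl))))
    where
    square : 2 ^ (2 * suc k) ≡ 2 ^ suc k * 2 ^ suc k
    square = trans (^-distribˡ-+-* 2 (suc k) (suc k + 0))
                   (cong (λ m → 2 ^ suc k * 2 ^ m) (+-identityʳ (suc k)))

  OnUV : Var n (suc k) → Set
  OnUV y = proj₁ y ≡ u ⊎ proj₁ y ≡ v

  proof-pivots : AllPivots OnUV (tree proof)
  proof-pivots = ViaV.derived-pivots OnUV (λ _ → inj₂ refl)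
    (λ t t-odd → ViaU.derived-pivots t t-odd OnUV (λ _ → inj₁ refl) (λ _ _ → tt))

  Covers : ℕ → List (Var n (suc k)) → Set
  Covers r vs = (∀ y → y ∈ vs → proj₁ y ≡ v) × (∀ j → toℕ j < r → (v , j) ∈ vs)

  covers-next : ∀ r (r<k : r < suc k) {vs} → Covers r vs → Covers (suc r) ((v , fromℕ< r<k) ∷ vs)
  covers-next r r<k (all-v , has-j) = on-v , has-j′
    where
    on-v : ∀ y → y ∈ (v , fromℕ< r<k) ∷ _ → proj₁ y ≡ v
    on-v y (here refl) = refl
    on-v y (there y∈) = all-v y y∈
    has-j′ : ∀ j → toℕ j < suc r → (v , j) ∈ (v , fromℕ< r<k) ∷ _
    has-j′ j j≤r with toℕ j ≟ r
    ... | yes j≡r = here (cong (v ,_) (toℕ-injective (trans j≡r (sym (toℕ-fromℕ< r<k)))))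
    ... | no j≢r  = there (has-j j (≤∧≢⇒< (≤-pred j≤r) j≢r))

  covers-all : ∀ {vs} → Covers (suc k) vs → (∀ y → y ∈ vs → proj₁ y ≡ v) × (∀ j → (v , j) ∈ vs)
  covers-all (all-v , has-j) = all-v , λ j → has-j j (toℕ<n j)

  not-in-xv : ∀ {C : Clause n (suc k)} {j q} → C ((u , j) , q) ≡ true → ¬ XorSet v true C
  not-in-xv u∈C xor = u≢v (XorSet-vertex xor u∈C)

  NotInXv : LeafCondition
  NotInXv C _ = ¬ XorSet v true C

  viaU-leaves : ∀ t t-odd → LeavesSatisfy NotInXv (tree (ViaU.derived t t-odd))
  viaU-leaves t t-odd =
    ViaU.derived-leaves t t-odd (λ _ → NotInXv)
      (λ r _ → not-in-xv (signClause-own u r fzero))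
      (λ r _ → not-in-xv (cong (_∨ (signClause v t ∪ᶜ target) ((u , fzero) , not (r fzero)))
                                (signClause-own u r fzero)))
      (λ _ _ _ _ not-xv → not-xv)

  CoveredIfInXv : ℕ → LeafCondition
  CoveredIfInXv r C vs = XorSet v true C → Covers r vs

  proof-leaves : LeavesSatisfy (CoveredIfInXv (suc k)) (tree proof)
  proof-leaves =
    ViaV.derived-leaves CoveredIfInXv
      (λ _ _ _ → (λ _ ()) , (λ _ ()))
      (λ t t-odd → LeavesSatisfy-mono (tree (ViaU.derived t t-odd)) {NotInXv} {CoveredIfInXv 0}
                                      (λ C vs not-xv xv → ⊥-elim (not-xv xv)) (viaU-leaves t t-odd))
      (λ r r<k C vs covers xv → covers-next r r<k (covers xv))

lemma4 : {n : ℕ} (G : PointedDag n) (k : ℕ) → 1 ≤ k →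
         (u v w : Fin n) → PointedDag.E G u w ≡ true → PointedDag.E G v w ≡ true → u ≢ v →
         (C : Clause n k) → XorSet w true C →
         Σ (Derivation (Axioms u v w) C) λ P →
           (resCount P < 2 ^ (2 * k)) × ResolvesOnlyOn P u v × PathsToXorExact P v
lemma4 G (suc k) _ u v w u→w v→w u≢v C (s , s-even , C≈s) =
  toDerivation π ,
  subst (_< 2 ^ (2 * suc k)) (sym (resCount-toDerivation π)) proof-size ,
  pivots-toDerivation π OnUV proof-pivots ,
  λ b initial xv vs path → covers-all (leaves-toDerivation π (CoveredIfInXv (suc k)) proof-leaves b initial vs path xv)
  where
  open Construction u v w u≢v (edge-distinct G u→w) (edge-distinct G v→w) s s-even
  open TreeProofs (Axioms {k = suc k} u v w)
  π = retarget proof (λ l → sym (C≈s l))
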